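{- Let $k \geq 1$ and let $\mathcal{A} = \{a_1 \prec a_2 \prec \cdots \prec a_k\}$ be a totally ordered alphabet with $k$ letters. Let $l = l_1 l_2 \cdots l_N$ be a Lyndon word over $\mathcal{A}$. Then the Lyndon graph $G(l)$ of $l$ is connected.
   Context: Words over $\mathcal{A}$ are compared in the lexicographic order induced by $\prec$. A nonempty word $w$ is primitive if $w = u^m$ with $u$ a nonempty word implies $m = 1$. Two words $w, u$ are conjugate if $w = w_1 w_2$ and $u = w_2 w_1$ for some words $w_1, w_2$. A Lyndon word is a primitive word that is the lexicographically smallest word in its conjugacy class. For a word $w = w_1 w_2 \cdots w_N$ over $\mathcal{A}$, its Lyndon graph $G(w)$ is the simple undirected graph with vertex set $\{1, \dots, N\}$ in which, for $1 \le i < j \le N$, the vertices $i$ and $j$ are adjacent if and only if the scattered subword $w_i w_j$ has the form $a_r a_s$ with $1 \le r < s \le k$, i.e. $w_i \prec w_j$. -}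

module Defs where

open import Data.Nat using (ℕ; suc; _≥_)
open import Data.Fin using (Fin; _<_)
open import Data.List using (List; []; _∷_; _++_; length; lookup; concat; replicate)
open import Data.List.Relation.Binary.Lex.Strict using (Lex-≤)
open import Data.Product using (Σ; ∃; ∃-syntax; _×_; _,_)
open import Data.Sum using (_⊎_)
open import Relation.Binary.PropositionalEquality using (_≡_)
open import Relation.Binary.Construct.Closure.ReflexiveTransitive using (Star)
open import Relation.Nullary using (¬_)

-- The alphabet a₁ ≺ ⋯ ≺ a_k is modelled as Fin k with its usual strict order.
Word : ℕ → Set
Word k = List (Fin k)

_≤lex_ : ∀ {k} → Word k → Word k → Set
_≤lex_ = Lex-≤ _≡_ _<_

Primitive : ∀ {k} → Word k → Set
Primitive {k} w = ¬ (w ≡ []) ×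
  (∀ (u : Word k) (m : ℕ) → ¬ (u ≡ []) → w ≡ concat (replicate m u) → m ≡ 1)

Conjugate : ∀ {k} → Word k → Word k → Set
Conjugate {k} w u = ∃[ w₁ ] ∃[ w₂ ] (w ≡ w₁ ++ w₂ × u ≡ w₂ ++ w₁)

Lyndon : ∀ {k} → Word k → Set
Lyndon w = Primitive w × (∀ u → Conjugate w u → w ≤lex u)

LyndonEdge : ∀ {k} (w : Word k) → Fin (length w) → Fin (length w) → Set
LyndonEdge w i j =
  (i < j × lookup w i < lookup w j) ⊎ (j < i × lookup w j < lookup w i)

Connected : ∀ {V : Set} → (V → V → Set) → Set
Connected {V} E = ∀ (x y : V) → Star E x y

LyndonGraphConnected : ∀ {k} → Word k → Set
LyndonGraphConnected w = Connected (LyndonEdge w)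

{-# OPTIONS --safe #-}
-- The first letter x of a Lyndon word is a least letter: a smaller letter e would
-- start a rotation e ⋯ below the word. If the word has length ≥ 2, its last letter z
-- is even strictly greater than x: were z = x, the rotation z u of the word u z would
-- force every letter to equal x, and the word would be a power of a single letter.
-- So position 1 is adjacent to every position carrying a letter > x, and every
-- position carrying x is adjacent to the last position, itself adjacent to position 1.
module Submission where

open import Defs
open import Data.Nat using (ℕ; _≥_; z≤n)
open import Data.Fin using (Fin; zero; fromℕ; _<_; _≤_)
open import Data.Fin.Properties using (<-cmp; <-asym; <-irrefl; ≤∧≢⇒<; ≤fromℕ)
open import Data.List using ([]; _∷_; _++_; _∷ʳ_; [_]; length; lookup; concat; replicate)
open import Data.List.Relation.Unary.All as All using (All; []; _∷_)
open import Data.List.Relation.Unary.All.Properties using (++⁻ˡ; ∷ʳ⁺; ∷ʳ⁻)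
open import Data.List.Membership.Propositional.Properties using (∈-∃++; ∈-lookup)
open import Data.List.Relation.Binary.Lex.Strict using (this; next)
open import Data.Product using (∃-syntax; _,_; proj₂)
open import Data.Sum using (inj₁; inj₂)
open import Relation.Binary.Definitions using (Symmetric; tri<; tri≈; tri>)
open import Relation.Binary.PropositionalEquality using (_≡_; refl; sym; cong; subst)
open import Relation.Binary.Construct.Closure.ReflexiveTransitive using (Star; ε; _◅_; _◅◅_; reverse)
open import Relation.Nullary using (¬_; contradiction)

hub⇒connected : ∀ {V : Set} {E : V → V → Set} → Symmetric E →
                (c : V) → (∀ v → Star E c v) → Connected E
hub⇒connected sym-E c reach u v = reverse sym-E (reach u) ◅◅ reach v

lookup-last-∷ʳ : ∀ {A : Set} (x : A) xs →
                 ∃[ u ] x ∷ xs ≡ u ∷ʳ lookup (x ∷ xs) (fromℕ (length xs))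
lookup-last-∷ʳ x []       = [] , refl
lookup-last-∷ʳ x (y ∷ ys) with u , eq ← lookup-last-∷ʳ y ys = x ∷ u , cong (x ∷_) eq

All-≡⇒≡-concat-replicate : ∀ {A : Set} {a : A} {w} →
                           All (_≡ a) w → w ≡ concat (replicate (length w) [ a ])
All-≡⇒≡-concat-replicate []           = refl
All-≡⇒≡-concat-replicate (refl ∷ w≡a) = cong (_ ∷_) (All-≡⇒≡-concat-replicate w≡a)

Primitive∧All-≡⇒length≡1 : ∀ {k} {a : Fin k} {w} → Primitive w → All (_≡ a) w → length w ≡ 1
Primitive∧All-≡⇒length≡1 {a = a} (_ , power⇒1) w≡a =
  power⇒1 [ a ] _ (λ ()) (All-≡⇒≡-concat-replicate w≡a)

≤lex-head : ∀ {k} {x y : Fin k} {xs ys} → (x ∷ xs) ≤lex (y ∷ ys) → ¬ y < x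
≤lex-head (this x<y)   = <-asym x<y
≤lex-head (next refl _) = <-irrefl refl

∷ʳ-≤lex-rotation⇒All-≡ : ∀ {k} (a : Fin k) u →
                         All (λ e → ¬ e < a) u → (u ∷ʳ a) ≤lex (a ∷ u) → All (_≡ a) u
∷ʳ-≤lex-rotation⇒All-≡ a []       _          _             = []
∷ʳ-≤lex-rotation⇒All-≡ a (p ∷ ps) (p≮a ∷ _)  (this p<a)    = contradiction p<a p≮a
∷ʳ-≤lex-rotation⇒All-≡ a (a ∷ ps) (_ ∷ ps≮a) (next refl r) =
  refl ∷ ∷ʳ-≤lex-rotation⇒All-≡ a ps ps≮a r

Lyndon⇒head-minimal : ∀ {k} {x : Fin k} {xs} → Lyndon (x ∷ xs) → All (λ e → ¬ e < x) (x ∷ xs)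
Lyndon⇒head-minimal (_ , least) = All.tabulate λ e∈w →
  let ys , zs , w≡ys·e·zs = ∈-∃++ e∈w
  in ≤lex-head (least (_ ∷ zs ++ ys) (ys , _ ∷ zs , w≡ys·e·zs , refl))

Lyndon⇒head<last : ∀ {k} {x y : Fin k} {ys u z} →
                   Lyndon (x ∷ y ∷ ys) → x ∷ y ∷ ys ≡ u ∷ʳ z → x < z
Lyndon⇒head<last {x = x} {u = u} {z} ly@(prim , least) w≡uz with <-cmp x z
... | tri< x<z _ _ = x<z
... | tri> _ _ z<x = contradiction z<x (proj₂ (∷ʳ⁻ (subst (All _) w≡uz (Lyndon⇒head-minimal ly))))
... | tri≈ _ refl _ = contradiction (Primitive∧All-≡⇒length≡1 prim w≡x) λ ()
  where
  rotation : (u ∷ʳ x) ≤lex (x ∷ u)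
  rotation = subst (_≤lex (x ∷ u)) w≡uz (least (x ∷ u) (u , [ x ] , w≡uz , refl))
  u≮x : All (λ e → ¬ e < x) u
  u≮x = ++⁻ˡ u (subst (All _) w≡uz (Lyndon⇒head-minimal ly))
  w≡x : All (_≡ x) _
  w≡x = subst (All (_≡ x)) (sym w≡uz) (∷ʳ⁺ (∷ʳ-≤lex-rotation⇒All-≡ x u u≮x rotation) refl)

LyndonEdge-sym : ∀ {k} (w : Word k) → Symmetric (LyndonEdge w)
LyndonEdge-sym w (inj₁ i<j) = inj₂ i<j
LyndonEdge-sym w (inj₂ j<i) = inj₁ j<i

LyndonEdge-≤ : ∀ {k} (w : Word k) {i j} → i ≤ j → lookup w i < lookup w j → LyndonEdge w i j
LyndonEdge-≤ w i≤j wᵢ<wⱼ = inj₁ (≤∧≢⇒< i≤j (λ { refl → <-irrefl refl wᵢ<wⱼ }) , wᵢ<wⱼ)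

head-reaches : ∀ {k} {x : Fin k} {xs} → All (λ e → ¬ e < x) (x ∷ xs) →
               x < lookup (x ∷ xs) (fromℕ (length xs)) →
               ∀ i → Star (LyndonEdge (x ∷ xs)) zero i
head-reaches {x = x} {xs} x-least x<last i with <-cmp x (lookup (x ∷ xs) i)
... | tri< x<wᵢ _ _ = LyndonEdge-≤ (x ∷ xs) z≤n x<wᵢ ◅ ε
... | tri> _ _ wᵢ<x = contradiction wᵢ<x (All.lookup x-least (∈-lookup i))
... | tri≈ _ x≡wᵢ _ =
  LyndonEdge-≤ (x ∷ xs) z≤n x<last ◅
  LyndonEdge-sym (x ∷ xs) (LyndonEdge-≤ (x ∷ xs) (≤fromℕ i) (subst (_< _) x≡wᵢ x<last)) ◅ ε

lemma2p3 : (k : ℕ) → k ≥ 1 → (l : Word k) → Lyndon l → LyndonGraphConnected l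
lemma2p3 k _ []           _  ()
lemma2p3 k _ (x ∷ [])     _  zero zero = ε
lemma2p3 k _ (x ∷ y ∷ ys) ly =
  hub⇒connected (LyndonEdge-sym (x ∷ y ∷ ys)) zero (head-reaches (Lyndon⇒head-minimal ly) head<last)
  where
  head<last : x < lookup (x ∷ y ∷ ys) (fromℕ (length (y ∷ ys)))
  head<last with _ , w≡u∷ʳlast ← lookup-last-∷ʳ x (y ∷ ys) = Lyndon⇒head<last ly w≡u∷ʳlast
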